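{- Let $k\ge 3$ and let $H$ be any tournament on $k$ vertices. Then $f(H)\le \lfloor k^2/4\rfloor$.
   Context: A tournament is an orientation of a complete graph. Directed graphs have no loops or parallel arcs but may contain directed 2-cycles. For a directed graph $L$, the blowup $B(L)$ replaces each vertex $v$ by a countably infinite independent set $I_v$ with all arcs from $I_a$ to $I_b$ whenever $(a,b)\in E(L)$. ${\rm disc}_H(L)$ is the minimum number of arcs that must be added to $B(L)$ to obtain a copy of $H$. $f(H,L)=\max\{|E(H)|(1-|E(L)|/|V(L)|^2),\,|E(H)|-{\rm disc}_H(L)\}$ and $f(H)=\inf_L f(H,L)$ over all directed graphs $L$ with at least one arc. -}

module Defs where

open import Data.Nat as ℕ using (ℕ; zero; suc; _≤_)
open import Data.Nat.Properties using ()
open import Data.Bool using (Bool; true; false; if_then_else_)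
open import Data.Fin using (Fin)
open import Data.List using (map; allFin)
open import Data.Nat.ListAction using (sum)
open import Data.Product using (Σ; ∃; _×_; _,_)
open import Data.Sum using (_⊎_)
open import Data.Integer using (+_)
open import Data.Rational as ℚ using (ℚ; _/_; 1ℚ)
open import Function.Definitions using (Injective)
open import Relation.Binary.PropositionalEquality using (_≡_; _≢_)

-- A directed graph on vertex set Fin n: adjacency as a Boolean relation,
-- no loops (2-cycles are allowed, parallel arcs impossible by construction).
record Digraph (n : ℕ) : Set where
  field
    adj      : Fin n → Fin n → Bool
    loopless : ∀ i → adj i i ≡ false
open Digraph public

record Tournament (k : ℕ) : Set where
  field
    graph  : Digraph k
    orient : ∀ i j → i ≢ j →
             (adj graph i j ≡ true × adj graph j i ≡ false)
             ⊎ (adj graph i j ≡ false × adj graph j i ≡ true)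
open Tournament public

countPairs : (n : ℕ) → (Fin n → Fin n → Bool) → ℕ
countPairs n P = sum (map (λ i → sum (map (λ j → if P i j then 1 else 0) (allFin n))) (allFin n))

arcs : ∀ {n} → Digraph n → ℕ
arcs {n} G = countPairs n (adj G)

-- The blowup B(L): vertex set Fin n × ℕ, where I_v = {v} × ℕ (countably infinite),
-- with an arc (a , x) → (b , y) iff (a , b) ∈ E(L).
BVertex : ℕ → Set
BVertex n = Fin n × ℕ

blowupArc : ∀ {n} → Digraph n → BVertex n → BVertex n → Bool
blowupArc L (a , _) (b , _) = adj L a b

-- For an embedding φ of V(H) into V(B(L)), the number of arcs of H that are
-- missing in B(L) (i.e. must be added to B(L) so that φ gives a copy of H).
missing : ∀ {k n} → Digraph k → Digraph n → (Fin k → BVertex n) → ℕ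
missing {k} H L φ =
  countPairs k (λ u v → if adj H u v then (if blowupArc L (φ u) (φ v) then false else true) else false)

IsDisc : ∀ {k n} → Digraph k → Digraph n → ℕ → Set
IsDisc {k} {n} H L d =
  (Σ (Fin k → BVertex n) λ φ → Injective _≡_ _≡_ φ × missing H L φ ≡ d)
  × (∀ (φ : Fin k → BVertex n) → Injective _≡_ _≡_ φ → d ≤ missing H L φ)

toℚ : ℕ → ℚ
toℚ m = + m / 1

fHL : ∀ {k m} → Digraph k → Digraph (suc m) → ℕ → ℚ
fHL {k} {m} H L d =
  (toℚ (arcs H) ℚ.* (1ℚ ℚ.- (+ arcs L / (suc m ℕ.* suc m))))
  ℚ.⊔ (toℚ (arcs H) ℚ.- toℚ d)

module Submission where

-- Take L to be the directed 2-cycle L₂, so that |E(L)|/|V(L)|² = 1/2. An injection of V(H)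
-- into B(L₂) is a 2-colouring of V(H), with classes of sizes α + β = k, and the arcs to be
-- added are the arcs of H inside a class. As H is a tournament, summing over pairs of vertices
-- gives 2·missing + k = α² + β² and 2·|E(H)| + k = k², hence missing = |E(H)| − αβ. By AM–GM
-- the best colouring is the balanced one, so disc_H(L₂) = |E(H)| − ⌊k²/4⌋, and
-- f(H, L₂) = max {|E(H)|/2, ⌊k²/4⌋} = ⌊k²/4⌋ because |E(H)| = k(k − 1)/2 ≤ 2⌊k²/4⌋.

open import Defs
open import Data.Nat as ℕ using (ℕ; suc; _≤_; _/_)
open import Data.Product using (Σ; _×_)
open import Data.Rational as ℚ using (ℚ; 0ℚ)
open import Relation.Binary.PropositionalEquality using (_≡_)

open import Data.Bool using (Bool; true; false; if_then_else_; not)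
open import Data.Fin using (Fin; zero; suc; toℕ; _≟_)
open import Data.Fin.Properties using (toℕ-injective)
import Data.Integer as ℤ
import Data.Integer.Properties as ℤP
open import Data.List using (map; tabulate)
open import Data.Nat using (zero; _+_; _*_; _∸_; z≤n; s≤s; _<ᵇ_)
open import Data.Nat.Coprimality as Coprime using (1-coprimeTo)
open import Data.Nat.DivMod using (m*n/n≡m; +-distrib-/-∣ʳ; /-monoˡ-≤)
open import Data.Nat.Divisibility using (n∣m*n)
import Data.Nat.ListAction as List
open import Data.Nat.Properties hiding (_≟_)
open import Data.Nat.Tactic.RingSolver using (solve-∀)
open import Data.Product using (∃₂; _,_; proj₁; proj₂)
open import Data.Rational using (mkℚ; 1ℚ; ½)
import Data.Rational.Properties as ℚP
import Data.Rational.Unnormalised as ℚᵘ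
import Data.Rational.Unnormalised.Properties as ℚᵘP
open import Data.Sum using (_⊎_; inj₁; inj₂; [_,_]′)
open import Function using (_∘_)
open import Function.Definitions using (Injective)
open import Relation.Binary.PropositionalEquality
  using (refl; sym; trans; cong; cong₂; subst; subst₂; module ≡-Reasoning)
open import Relation.Nullary using (does; yes; no)
open import Relation.Nullary.Decidable using (dec-true)

open import Algebra.Properties.AbelianGroup ℚP.+-0-abelianGroup using (xyx⁻¹≈y)
open import Algebra.Properties.Semiring.Sum +-*-semiring
  using (sum-syntax; sum-cong-≗; sum-replicate-zero; ∑-distrib-+; ∑-comm; *-distribʳ-sum)

⟦_⟧ : Bool → ℕ
⟦ b ⟧ = if b then 1 else 0

δ : ∀ {n} → Fin n → Fin n → ℕ
δ i j = ⟦ does (i ≟ j) ⟧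

δ-refl : ∀ {n} (i : Fin n) → δ i i ≡ 1
δ-refl zero    = refl
δ-refl (suc i) = δ-refl i

δ-sym : ∀ {n} (i j : Fin n) → δ i j ≡ δ j i
δ-sym zero    zero    = refl
δ-sym zero    (suc j) = refl
δ-sym (suc i) zero    = refl
δ-sym (suc i) (suc j) = δ-sym i j

∑-const : ∀ n c → ∑[ i < n ] c ≡ n * c
∑-const zero    c = refl
∑-const (suc n) c = cong (c +_) (∑-const n c)

∑-δ : ∀ {n} (i : Fin n) (g : Fin n → ℕ) → ∑[ j < n ] (δ i j * g j) ≡ g i
∑-δ {suc n} zero    g =
  trans (cong₂ _+_ (+-identityʳ (g zero)) (sum-replicate-zero n)) (+-identityʳ (g zero))
∑-δ {suc n} (suc i) g = ∑-δ i (g ∘ suc)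

sum-map-tabulate : ∀ {A : Set} n (f : A → ℕ) (g : Fin n → A) →
                   List.sum (map f (tabulate g)) ≡ ∑[ i < n ] f (g i)
sum-map-tabulate zero    f g = refl
sum-map-tabulate (suc n) f g = cong (f (g zero) +_) (sum-map-tabulate n f (g ∘ suc))

∑² : ∀ {n} → (Fin n → Fin n → ℕ) → ℕ
∑² {n} f = ∑[ i < n ] ∑[ j < n ] f i j

countPairs-∑² : ∀ n P → countPairs n P ≡ ∑² (λ i j → ⟦ P i j ⟧)
countPairs-∑² n P = trans (sum-map-tabulate n _ (λ i → i))
  (sum-cong-≗ {n} (λ i → sum-map-tabulate n _ (λ j → j)))

∑²-cong : ∀ {n} {f g : Fin n → Fin n → ℕ} → (∀ i j → f i j ≡ g i j) → ∑² f ≡ ∑² g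
∑²-cong {n} f≗g = sum-cong-≗ {n} (λ i → sum-cong-≗ {n} (f≗g i))

∑²-distrib-+ : ∀ {n} (f g : Fin n → Fin n → ℕ) →
               ∑² (λ i j → f i j + g i j) ≡ ∑² f + ∑² g
∑²-distrib-+ {n} f g =
  trans (sum-cong-≗ {n} (λ i → ∑-distrib-+ (f i) (g i))) (∑-distrib-+ {n} _ _)

arc : ∀ {n} → Digraph n → Fin n → Fin n → ℕ
arc G u v = ⟦ adj G u v ⟧

arc-trichotomy : ∀ {k} (H : Tournament k) u v → arc (graph H) u v + arc (graph H) v u + δ u v ≡ 1
arc-trichotomy H u v with u ≟ v
... | yes refl rewrite loopless (graph H) u = refl
... | no u≢v with orient H u v u≢v
...   | inj₁ (uv , vu) rewrite uv | vu = refl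
...   | inj₂ (uv , vu) rewrite uv | vu = refl

∑²-tournament : ∀ {k} (H : Tournament k) (g : Fin k → Fin k → ℕ) →
                (∀ u v → g u v ≡ g v u) →
                2 * ∑² (λ u v → arc (graph H) u v * g u v) + ∑[ u < k ] g u u ≡ ∑² g
∑²-tournament {k} H g g-sym = begin
  2 * S + ∑[ u < k ] g u u
    ≡⟨ cong₂ _+_ (cong (S +_) (+-identityʳ S)) (sym diagonal) ⟩
  S + S + ∑² (λ u v → δ u v * g u v)
    ≡⟨ cong (λ x → S + x + ∑² (λ u v → δ u v * g u v)) transpose ⟩
  S + ∑² (λ u v → A v u * g u v) + ∑² (λ u v → δ u v * g u v)
    ≡⟨ cong (_+ ∑² (λ u v → δ u v * g u v)) (sym (∑²-distrib-+ {k} _ _)) ⟩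
  ∑² (λ u v → A u v * g u v + A v u * g u v) + ∑² (λ u v → δ u v * g u v)
    ≡⟨ sym (∑²-distrib-+ {k} _ _) ⟩
  ∑² (λ u v → A u v * g u v + A v u * g u v + δ u v * g u v)
    ≡⟨ ∑²-cong pointwise ⟩
  ∑² g ∎
  where
  open ≡-Reasoning
  A : Fin k → Fin k → ℕ
  A = arc (graph H)
  S : ℕ
  S = ∑² (λ u v → A u v * g u v)
  diagonal : ∑² (λ u v → δ u v * g u v) ≡ ∑[ u < k ] g u u
  diagonal = sum-cong-≗ {k} (λ u → ∑-δ u (g u))
  transpose : S ≡ ∑² (λ u v → A v u * g u v)
  transpose = trans (∑-comm {k} {k} (λ u v → A u v * g u v))
                    (∑²-cong (λ u v → cong (A v u *_) (g-sym v u)))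
  distrib : ∀ a b c x → a * x + b * x + c * x ≡ (a + b + c) * x
  distrib = solve-∀
  pointwise : ∀ u v → A u v * g u v + A v u * g u v + δ u v * g u v ≡ g u v
  pointwise u v = trans (distrib (A u v) (A v u) (δ u v) (g u v))
    (trans (cong (_* g u v) (arc-trichotomy H u v)) (*-identityˡ (g u v)))

∑-δ-diagonal : ∀ {k r} (c : Fin k → Fin r) → ∑[ u < k ] δ (c u) (c u) ≡ k
∑-δ-diagonal {k} c =
  trans (sum-cong-≗ {k} (λ u → δ-refl (c u))) (trans (∑-const k 1) (*-identityʳ k))

arcs-tournament : ∀ {k} (H : Tournament k) → 2 * arcs (graph H) + k ≡ k * k
arcs-tournament {k} H = begin
  2 * arcs (graph H) + k
    ≡⟨ cong₂ (λ e d → 2 * e + d) arcs≡ (sym (trans (∑-const k 1) (*-identityʳ k))) ⟩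
  2 * ∑² (λ u v → arc (graph H) u v * 1) + ∑[ u < k ] 1
    ≡⟨ ∑²-tournament H (λ _ _ → 1) (λ _ _ → refl) ⟩
  ∑[ u < k ] ∑[ v < k ] 1
    ≡⟨ trans (sum-cong-≗ {k} (λ _ → ∑-const k 1)) (∑-const k (k * 1)) ⟩
  k * (k * 1)
    ≡⟨ cong (k *_) (*-identityʳ k) ⟩
  k * k ∎
  where
  open ≡-Reasoning
  arcs≡ : arcs (graph H) ≡ ∑² (λ u v → arc (graph H) u v * 1)
  arcs≡ = trans (countPairs-∑² k _) (∑²-cong {k} (λ u v → sym (*-identityʳ _)))

classSize : ∀ {k r} → (Fin k → Fin r) → Fin r → ℕ
classSize {k} c i = ∑[ u < k ] δ (c u) i

∑-classSize : ∀ {k r} (c : Fin k → Fin r) → ∑[ i < r ] classSize c i ≡ k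
∑-classSize {k} {r} c = begin
  ∑[ i < r ] ∑[ u < k ] δ (c u) i  ≡⟨ ∑-comm {r} {k} (λ i u → δ (c u) i) ⟩
  ∑[ u < k ] ∑[ i < r ] δ (c u) i  ≡⟨ sum-cong-≗ {k} (λ u → one (c u)) ⟩
  ∑[ u < k ] 1                     ≡⟨ ∑-const k 1 ⟩
  k * 1                            ≡⟨ *-identityʳ k ⟩
  k                                ∎
  where
  open ≡-Reasoning
  one : ∀ j → ∑[ i < r ] δ j i ≡ 1
  one j = trans (sum-cong-≗ {r} (λ i → sym (*-identityʳ (δ j i)))) (∑-δ j (λ _ → 1))

∑²-sameClass : ∀ {k r} (c : Fin k → Fin r) →
               ∑² (λ u v → δ (c u) (c v)) ≡ ∑[ i < r ] (classSize c i * classSize c i)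
∑²-sameClass {k} {r} c = begin
  ∑[ u < k ] ∑[ v < k ] δ (c u) (c v)
    ≡⟨ ∑²-cong {k} (λ u v → δ-sym (c u) (c v)) ⟩
  ∑[ u < k ] N (c u)
    ≡⟨ sum-cong-≗ {k} (λ u → sym (∑-δ (c u) N)) ⟩
  ∑[ u < k ] ∑[ i < r ] (δ (c u) i * N i)
    ≡⟨ ∑-comm {k} {r} (λ u i → δ (c u) i * N i) ⟩
  ∑[ i < r ] ∑[ u < k ] (δ (c u) i * N i)
    ≡⟨ sum-cong-≗ {r} (λ i → sym (*-distribʳ-sum (N i) (λ u → δ (c u) i))) ⟩
  ∑[ i < r ] (N i * N i) ∎
  where
  open ≡-Reasoning
  N : Fin _ → ℕ
  N = classSize c

L₂ : Digraph 2
L₂ = record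
  { adj      = λ i j → not (does (i ≟ j))
  ; loopless = λ i → cong not (dec-true (i ≟ i) refl)
  }

⟦a∧¬¬b⟧≡⟦a⟧*⟦b⟧ : ∀ a b →
                  ⟦ if a then (if not b then false else true) else false ⟧ ≡ ⟦ a ⟧ * ⟦ b ⟧
⟦a∧¬¬b⟧≡⟦a⟧*⟦b⟧ true  true  = refl
⟦a∧¬¬b⟧≡⟦a⟧*⟦b⟧ true  false = refl
⟦a∧¬¬b⟧≡⟦a⟧*⟦b⟧ false _     = refl

missing-L₂ : ∀ {k} (G : Digraph k) (φ : Fin k → BVertex 2) →
             missing G L₂ φ ≡ ∑² (λ u v → arc G u v * δ (proj₁ (φ u)) (proj₁ (φ v)))
missing-L₂ {k} G φ = trans (countPairs-∑² k _)
  (∑²-cong {k} (λ u v → ⟦a∧¬¬b⟧≡⟦a⟧*⟦b⟧ (adj G u v) (does (c u ≟ c v))))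
  where
  c : Fin k → Fin 2
  c = proj₁ ∘ φ

classSize₂-+ : ∀ {k} (c : Fin k → Fin 2) → classSize c zero + classSize c (suc zero) ≡ k
classSize₂-+ c = trans (cong (classSize c zero +_) (sym (+-identityʳ _))) (∑-classSize c)

2m+k≡a²+b²⇒2e+k≡[a+b]²⇒m+ab≡e : ∀ m e a b k →
  2 * m + k ≡ a * a + b * b → 2 * e + k ≡ (a + b) * (a + b) → m + a * b ≡ e
2m+k≡a²+b²⇒2e+k≡[a+b]²⇒m+ab≡e m e a b k 2m+k≡ 2e+k≡ =
  *-cancelˡ-≡ (m + a * b) e 2 (+-cancelʳ-≡ k _ _ (begin
  2 * (m + a * b) + k          ≡⟨ regroup m (a * b) k ⟩
  (2 * m + k) + 2 * (a * b)    ≡⟨ cong (_+ 2 * (a * b)) 2m+k≡ ⟩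
  a * a + b * b + 2 * (a * b)  ≡⟨ square-+ a b ⟩
  (a + b) * (a + b)            ≡⟨ sym 2e+k≡ ⟩
  2 * e + k                    ∎))
  where
  open ≡-Reasoning
  regroup : ∀ m p k → 2 * (m + p) + k ≡ (2 * m + k) + 2 * p
  regroup = solve-∀
  square-+ : ∀ a b → a * a + b * b + 2 * (a * b) ≡ (a + b) * (a + b)
  square-+ = solve-∀

missing-L₂+α*β≡arcs : ∀ {k} (H : Tournament k) (φ : Fin k → BVertex 2) →
                     let c = proj₁ ∘ φ in
                     missing (graph H) L₂ φ + classSize c zero * classSize c (suc zero) ≡ arcs (graph H)
missing-L₂+α*β≡arcs {k} H φ = 2m+k≡a²+b²⇒2e+k≡[a+b]²⇒m+ab≡e _ _ α β k twice-missing twice-arcs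
  where
  open ≡-Reasoning
  c : Fin k → Fin 2
  c = proj₁ ∘ φ
  α β : ℕ
  α = classSize c zero
  β = classSize c (suc zero)
  twice-missing : 2 * missing (graph H) L₂ φ + k ≡ α * α + β * β
  twice-missing = begin
    2 * missing (graph H) L₂ φ + k
      ≡⟨ cong₂ (λ m d → 2 * m + d) (missing-L₂ (graph H) φ) (sym (∑-δ-diagonal c)) ⟩
    2 * ∑² (λ u v → arc (graph H) u v * δ (c u) (c v)) + ∑[ u < k ] δ (c u) (c u)
      ≡⟨ ∑²-tournament H (λ u v → δ (c u) (c v)) (λ u v → δ-sym (c u) (c v)) ⟩
    ∑² (λ u v → δ (c u) (c v))
      ≡⟨ ∑²-sameClass c ⟩
    α * α + (β * β + 0)
      ≡⟨ cong (α * α +_) (+-identityʳ (β * β)) ⟩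
    α * α + β * β ∎
  twice-arcs : 2 * arcs (graph H) + k ≡ (α + β) * (α + β)
  twice-arcs = trans (arcs-tournament H) (cong (λ n → n * n) (sym (classSize₂-+ c)))

parity : ∀ n → Σ ℕ λ h → n ≡ h + h ⊎ n ≡ suc (h + h)
parity zero = 0 , inj₁ refl
parity (suc n) with parity n
... | h , inj₁ n≡2h   = h , inj₂ (cong suc n≡2h)
... | h , inj₂ n≡2h+1 = suc h , inj₁ (trans (cong suc n≡2h+1) (cong suc (sym (+-suc h h))))

balanced-split : ∀ k → ∃₂ λ a b → a + b ≡ k × a * b ≡ k * k / 4 × k * k ≤ 4 * (a * b) + 1
balanced-split k with parity k
... | h , inj₁ refl = h , h , refl , sym even , ≤-trans (≤-reflexive (square-even h)) (m≤m+n _ 1)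
  where
  square-even : ∀ h → (h + h) * (h + h) ≡ 4 * (h * h)
  square-even = solve-∀
  even : (h + h) * (h + h) / 4 ≡ h * h
  even = trans (cong (_/ 4) (trans (square-even h) (*-comm 4 (h * h)))) (m*n/n≡m (h * h) 4)
... | h , inj₂ refl = h , suc h , +-suc h h , sym odd , ≤-reflexive (square-odd h)
  where
  square-odd : ∀ h → suc (h + h) * suc (h + h) ≡ 4 * (h * suc h) + 1
  square-odd = solve-∀
  odd : suc (h + h) * suc (h + h) / 4 ≡ h * suc h
  odd = begin
    suc (h + h) * suc (h + h) / 4 ≡⟨ cong (_/ 4) (square-odd′ h) ⟩
    (1 + h * suc h * 4) / 4       ≡⟨ +-distrib-/-∣ʳ 1 {d = 4} (n∣m*n (h * suc h)) ⟩
    h * suc h * 4 / 4             ≡⟨ m*n/n≡m (h * suc h) 4 ⟩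
    h * suc h                     ∎
    where
    open ≡-Reasoning
    square-odd′ : ∀ h → suc (h + h) * suc (h + h) ≡ 1 + h * suc h * 4
    square-odd′ = solve-∀

4*-≤-square : ∀ a b → 4 * (a * b) ≤ (a + b) * (a + b)
4*-≤-square a b = [ ordered , swapped ]′ (≤-total a b)
  where
  expand : ∀ a t → 4 * (a * (a + t)) + t * t ≡ (a + (a + t)) * (a + (a + t))
  expand = solve-∀
  ordered : ∀ {a b} → a ≤ b → 4 * (a * b) ≤ (a + b) * (a + b)
  ordered {a} a≤b = subst (λ b → 4 * (a * b) ≤ (a + b) * (a + b)) (m+[n∸m]≡n a≤b)
    (≤-trans (m≤m+n _ _) (≤-reflexive (expand a _)))
  swapped : b ≤ a → 4 * (a * b) ≤ (a + b) * (a + b)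
  swapped b≤a = subst₂ (λ p s → 4 * p ≤ s * s) (*-comm b a) (+-comm b a) (ordered b≤a)

*-≤-⌊square/4⌋ : ∀ a b → a * b ≤ (a + b) * (a + b) / 4
*-≤-⌊square/4⌋ a b = begin
  a * b                    ≡⟨ m*n/n≡m (a * b) 4 ⟨
  a * b * 4 / 4            ≡⟨ cong (_/ 4) (*-comm (a * b) 4) ⟩
  4 * (a * b) / 4          ≤⟨ /-monoˡ-≤ 4 (4*-≤-square a b) ⟩
  (a + b) * (a + b) / 4    ∎
  where open ≤-Reasoning

∑-<ᵇ : ∀ {n} a → a ≤ n → ∑[ u < n ] ⟦ toℕ u <ᵇ a ⟧ ≡ a
∑-<ᵇ {zero}  zero    _         = refl
∑-<ᵇ {suc n} zero    _         = sum-replicate-zero (suc n)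
∑-<ᵇ {suc n} (suc a) (s≤s a≤n) = cong suc (∑-<ᵇ a a≤n)

splitAt : ∀ {k} → ℕ → Fin k → BVertex 2
splitAt a u = (if toℕ u <ᵇ a then zero else suc zero) , toℕ u

splitAt-injective : ∀ {k} a → Injective _≡_ _≡_ (splitAt {k} a)
splitAt-injective a = toℕ-injective ∘ cong proj₂

classSize-splitAt : ∀ {k} a → a ≤ k → classSize (proj₁ ∘ splitAt {k} a) zero ≡ a
classSize-splitAt {k} a a≤k = trans (sum-cong-≗ {k} (λ u → δ-if (toℕ u <ᵇ a))) (∑-<ᵇ a a≤k)
  where
  δ-if : ∀ b → δ {2} (if b then zero else suc zero) zero ≡ ⟦ b ⟧
  δ-if true  = refl
  δ-if false = refl

module _ {k : ℕ} (H : Tournament k) where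

  arcs≤missing-L₂+⌊k²/4⌋ : ∀ φ → arcs (graph H) ≤ missing (graph H) L₂ φ + k * k / 4
  arcs≤missing-L₂+⌊k²/4⌋ φ = subst₂ _≤_ (missing-L₂+α*β≡arcs H φ) refl
    (+-monoʳ-≤ (missing (graph H) L₂ φ)
      (subst (λ n → α * β ≤ n * n / 4) (classSize₂-+ (proj₁ ∘ φ)) (*-≤-⌊square/4⌋ α β)))
    where
    α β : ℕ
    α = classSize (proj₁ ∘ φ) zero
    β = classSize (proj₁ ∘ φ) (suc zero)

  balanced-embedding : Σ (Fin k → BVertex 2) λ φ →
    Injective _≡_ _≡_ φ × missing (graph H) L₂ φ + k * k / 4 ≡ arcs (graph H)
  balanced-embedding with balanced-split k
  ... | a , b , a+b≡k , ab≡⌊k²/4⌋ , _ = splitAt a , splitAt-injective a ,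
    trans (cong (missing (graph H) L₂ (splitAt a) +_) (sym αβ≡⌊k²/4⌋))
          (missing-L₂+α*β≡arcs H (splitAt a))
    where
    c : Fin k → Fin 2
    c = proj₁ ∘ splitAt a
    α≡a : classSize c zero ≡ a
    α≡a = classSize-splitAt a (subst (a ≤_) a+b≡k (m≤m+n a b))
    β≡b : classSize c (suc zero) ≡ b
    β≡b = +-cancelˡ-≡ a _ _
      (trans (subst (λ x → x + classSize c (suc zero) ≡ k) α≡a (classSize₂-+ c)) (sym a+b≡k))
    αβ≡⌊k²/4⌋ : classSize c zero * classSize c (suc zero) ≡ k * k / 4
    αβ≡⌊k²/4⌋ = trans (cong₂ _*_ α≡a β≡b) ab≡⌊k²/4⌋

  disc-L₂ : IsDisc (graph H) L₂ (arcs (graph H) ∸ k * k / 4)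
  disc-L₂ = (φ₀ , φ₀-injective , missing≡) , minimal
    where
    φ₀ = proj₁ balanced-embedding
    φ₀-injective = proj₁ (proj₂ balanced-embedding)
    missing≡ : missing (graph H) L₂ φ₀ ≡ arcs (graph H) ∸ k * k / 4
    missing≡ = trans (sym (m+n∸n≡m _ (k * k / 4)))
                     (cong (_∸ k * k / 4) (proj₂ (proj₂ balanced-embedding)))
    minimal : ∀ φ → Injective _≡_ _≡_ φ →
              arcs (graph H) ∸ k * k / 4 ≤ missing (graph H) L₂ φ
    minimal φ _ = m≤n+o⇒m∸n≤o (arcs (graph H)) (k * k / 4)
      (subst (arcs (graph H) ≤_) (+-comm _ (k * k / 4)) (arcs≤missing-L₂+⌊k²/4⌋ φ))

  arcs≤2⌊k²/4⌋ : 1 ≤ k → arcs (graph H) ≤ k * k / 4 + k * k / 4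
  arcs≤2⌊k²/4⌋ 1≤k with balanced-split k
  ... | a , b , _ , ab≡⌊k²/4⌋ , k²≤4ab+1 = *-cancelˡ-≤ 2 (+-cancelʳ-≤ k _ _ (begin
    2 * arcs (graph H) + k  ≡⟨ arcs-tournament H ⟩
    k * k                   ≤⟨ k²≤4ab+1 ⟩
    4 * (a * b) + 1         ≤⟨ +-monoʳ-≤ (4 * (a * b)) 1≤k ⟩
    4 * (a * b) + k         ≡⟨ cong (λ x → 4 * x + k) ab≡⌊k²/4⌋ ⟩
    4 * F + k               ≡⟨ cong (_+ k) (quadruple F) ⟩
    2 * (F + F) + k         ∎))
    where
    open ≤-Reasoning
    F : ℕ
    F = k * k / 4
    quadruple : ∀ n → 4 * n ≡ 2 * (n + n)
    quadruple = solve-∀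

  ⌊k²/4⌋≤arcs : k * k / 4 ≤ arcs (graph H)
  ⌊k²/4⌋≤arcs = subst (k * k / 4 ≤_) (proj₂ (proj₂ balanced-embedding)) (m≤n+m _ _)

toℚ≡mkℚ : ∀ m → toℚ m ≡ mkℚ (ℤ.+ m) 0 (Coprime.sym (1-coprimeTo m))
toℚ≡mkℚ m = ℚP.normalize-coprime (Coprime.sym (1-coprimeTo m))

toℚ-+ : ∀ m n → toℚ (m + n) ≡ toℚ m ℚ.+ toℚ n
toℚ-+ m n = ℚP.toℚᵘ-injective
  (ℚᵘP.≃-trans unnormalised (ℚᵘP.≃-sym (ℚP.toℚᵘ-homo-+ (toℚ m) (toℚ n))))
  where
  unnormalised : ℚ.toℚᵘ (toℚ (m + n)) ℚᵘ.≃ ℚ.toℚᵘ (toℚ m) ℚᵘ.+ ℚ.toℚᵘ (toℚ n)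
  unnormalised rewrite toℚ≡mkℚ m | toℚ≡mkℚ n | toℚ≡mkℚ (m + n) = ℚᵘ.*≡*
    (cong₂ ℤ._*_ (cong₂ ℤ._+_ (sym (ℤP.*-identityʳ (ℤ.+ m))) (sym (ℤP.*-identityʳ (ℤ.+ n)))) refl)

toℚ-mono-≤ : ∀ {m n} → m ≤ n → toℚ m ℚ.≤ toℚ n
toℚ-mono-≤ {m} {n} m≤n rewrite toℚ≡mkℚ m | toℚ≡mkℚ n =
  ℚ.*≤* (subst₂ ℤ._≤_ (sym (ℤP.*-identityʳ _)) (sym (ℤP.*-identityʳ _)) (ℤ.+≤+ m≤n))

toℚ-∸ : ∀ {m n} → n ≤ m → toℚ m ℚ.- toℚ (m ∸ n) ≡ toℚ n
toℚ-∸ {m} {n} n≤m = begin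
  toℚ m ℚ.- toℚ d          ≡⟨ cong (λ x → toℚ x ℚ.- toℚ d) (m∸n+n≡m n≤m) ⟨
  toℚ (d + n) ℚ.- toℚ d    ≡⟨ cong (ℚ._- toℚ d) (toℚ-+ d n) ⟩
  toℚ d ℚ.+ toℚ n ℚ.- toℚ d ≡⟨ xyx⁻¹≈y (toℚ d) (toℚ n) ⟩
  toℚ n                    ∎
  where
  open ≡-Reasoning
  d : ℕ
  d = m ∸ n

toℚ-half-≤ : ∀ {m n} → m ≤ n + n → toℚ m ℚ.* ½ ℚ.≤ toℚ n
toℚ-half-≤ {m} {n} m≤2n =
  ℚP.≤-trans (ℚP.*-monoʳ-≤-nonNeg ½ (toℚ-mono-≤ m≤2n)) (ℚP.≤-reflexive half-double)
  where
  half-double : toℚ (n + n) ℚ.* ½ ≡ toℚ n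
  half-double = begin
    toℚ (n + n) ℚ.* ½               ≡⟨ cong (ℚ._* ½) (toℚ-+ n n) ⟩
    (toℚ n ℚ.+ toℚ n) ℚ.* ½         ≡⟨ ℚP.*-distribʳ-+ ½ (toℚ n) (toℚ n) ⟩
    toℚ n ℚ.* ½ ℚ.+ toℚ n ℚ.* ½     ≡⟨ sym (ℚP.*-distribˡ-+ (toℚ n) ½ ½) ⟩
    toℚ n ℚ.* 1ℚ                    ≡⟨ ℚP.*-identityʳ (toℚ n) ⟩
    toℚ n                           ∎
    where open ≡-Reasoning

-- The first step is by computation: |E(L₂)| = 2, and 1 − 2/4 normalises to ½.
fHL-L₂ : ∀ {k} → 1 ≤ k → (H : Tournament k) →
         fHL (graph H) L₂ (arcs (graph H) ∸ k * k / 4) ≡ toℚ (k * k / 4)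
fHL-L₂ {k} 1≤k H = begin
  fHL (graph H) L₂ (E ∸ F)                 ≡⟨⟩
  toℚ E ℚ.* ½ ℚ.⊔ (toℚ E ℚ.- toℚ (E ∸ F))
    ≡⟨ cong (toℚ E ℚ.* ½ ℚ.⊔_) (toℚ-∸ (⌊k²/4⌋≤arcs H)) ⟩
  toℚ E ℚ.* ½ ℚ.⊔ toℚ F
    ≡⟨ ℚP.p≤q⇒p⊔q≡q (toℚ-half-≤ {n = F} (arcs≤2⌊k²/4⌋ H 1≤k)) ⟩
  toℚ F                                    ∎
  where
  open ≡-Reasoning
  E F : ℕ
  E = arcs (graph H)
  F = k * k / 4

mainTheorem15 : (k : ℕ) → 3 ≤ k → (H : Tournament k) →
    (ε : ℚ) → 0ℚ ℚ.< ε →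
    Σ ℕ λ m → Σ (Digraph (suc m)) λ L → 1 ≤ arcs L ×
      (Σ ℕ λ d → IsDisc (graph H) L d ×
        fHL (graph H) L d ℚ.≤ (toℚ ((k ℕ.* k) / 4) ℚ.+ ε))
mainTheorem15 k 3≤k H ε 0<ε =
  1 , L₂ , s≤s z≤n , arcs (graph H) ∸ k * k / 4 , disc-L₂ H , (begin
    fHL (graph H) L₂ (arcs (graph H) ∸ k * k / 4)  ≡⟨ fHL-L₂ (≤-trans (s≤s z≤n) 3≤k) H ⟩
    toℚ (k * k / 4)                                ≡⟨ ℚP.+-identityʳ _ ⟨
    toℚ (k * k / 4) ℚ.+ 0ℚ                         ≤⟨ ℚP.+-monoʳ-≤ (toℚ (k * k / 4)) (ℚP.<⇒≤ 0<ε) ⟩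
    toℚ (k * k / 4) ℚ.+ ε                          ∎)
  where open ℚP.≤-Reasoning
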